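{- Let $p$ be a prime, let $(K,\partial)$ be a differential field of characteristic $p$, and let $k\ge 0$ be an integer. If $u\in K$ satisfies $\partial^{p^k}(u)\in C(K)^{\times}$ and $y\in K$ satisfies $\partial(y)=\partial(u)/u$, then $\partial^{p^{k+1}}(y)\in C(K)^{\times}$.
   Context: A derivation on a field $K$ is an additive map $\partial:K\to K$ with $\partial(ab)=\partial(a)b+a\partial(b)$; $C(K)=\ker\partial$ is the field of constants and $C(K)^{\times}=C(K)\setminus\{0\}$. $\partial^m$ denotes the $m$-fold iterate of $\partial$. -}

module Defs where

open import Level using (Level; _⊔_) renaming (suc to lsuc)
open import Data.Nat as ℕ using (ℕ; zero; suc; _<_)
open import Relation.Nullary using (¬_)
open import Data.Product using (_×_)
open import Algebra.Bundles using (CommutativeRing)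

record Field (c ℓ : Level) : Set (lsuc (c ⊔ ℓ)) where
  field
    commutativeRing : CommutativeRing c ℓ
  open CommutativeRing commutativeRing public
  field
    1≉0     : ¬ (1# ≈ 0#)
    inv     : (x : Carrier) → ¬ (x ≈ 0#) → Carrier
    inverse : (x : Carrier) (x≉0 : ¬ (x ≈ 0#)) → x * inv x x≉0 ≈ 1#

module _ {c ℓ} (K : Field c ℓ) where
  open Field K

  ι : ℕ → Carrier
  ι zero    = 0#
  ι (suc n) = 1# + ι n

  HasCharacteristic : ℕ → Set ℓ
  HasCharacteristic n =
    (0 < n) × (ι n ≈ 0#) × (∀ m → 0 < m → m < n → ¬ (ι m ≈ 0#))

  record IsDerivation (∂ : Carrier → Carrier) : Set (c ⊔ ℓ) where
    field
      ∂-cong    : ∀ {a b} → a ≈ b → ∂ a ≈ ∂ b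
      ∂-additive : ∀ a b → ∂ (a + b) ≈ ∂ a + ∂ b
      ∂-leibniz  : ∀ a b → ∂ (a * b) ≈ ∂ a * b + a * ∂ b

  iter : (Carrier → Carrier) → ℕ → Carrier → Carrier
  iter ∂ zero    x = x
  iter ∂ (suc m) x = ∂ (iter ∂ m x)

  InConstantsˣ : (Carrier → Carrier) → Carrier → Set ℓ
  InConstantsˣ ∂ x = (∂ x ≈ 0#) × ¬ (x ≈ 0#)

{-# OPTIONS --safe #-}
-- Put D = ∂^N with N = p^k. In characteristic p the binomial coefficients (p choose i), 0 < i < p,
-- vanish, so by the Leibniz rule ∂^p, and hence D, is again a derivation. Let c = D u and v = 1/u.
-- Since D commutes with ∂, ∂ (D y) = D (∂u · v) = ∂c · v + c · ∂v = ∂ (c v), using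
-- ∂u · D v = -c ∂u v² = c · ∂v; so D y - c v is a constant and D² y = D (c v).
-- From D v = -c v² one gets D^m v = m! (-c)^m v^(m+1), hence
-- ∂^(pN) y = D^(p-1) (D y) = c (p-1)! (-c)^(p-1) v^p, a product of nonzero constants
-- (∂ (v^p) = p v^(p-1) ∂v = 0).
module Submission where

open import Defs
open import Data.Nat using (ℕ; suc)
open import Data.Nat.Primality using (Prime)
open import Relation.Nullary using (¬_)

import Data.Nat as ℕ
import Data.Nat.Properties as ℕₚ
open import Data.Nat using (zero; _<_; s≤s; z<s; _!)
open import Data.Nat.Properties using (n<1+n; <-trans)
open import Data.Nat.Combinatorics using (_C_; nC1≡n; nCn≡1; k>n⇒nCk≡0; nCk+nC[k+1]≡[n+1]C[k+1])
open import Data.Nat.Solver using (module +-*-Solver)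
open import Data.Product using (_,_; proj₁)
open import Function using (_∘_)
open import Relation.Nullary using (contradiction)
open import Relation.Binary.PropositionalEquality as ≡ using (_≡_; _≗_)

[1+k]*[1+n]C[1+k]≡[1+n]*nCk : ∀ n k → suc k ℕ.* (suc n C suc k) ≡ suc n ℕ.* (n C k)
[1+k]*[1+n]C[1+k]≡[1+n]*nCk n zero = begin
  1 ℕ.* (suc n C 1)  ≡⟨ ℕₚ.*-identityˡ _ ⟩
  suc n C 1          ≡⟨ nC1≡n (suc n) ⟩
  suc n              ≡⟨ ℕₚ.*-identityʳ (suc n) ⟨
  suc n ℕ.* 1        ∎
  where open ≡.≡-Reasoning
[1+k]*[1+n]C[1+k]≡[1+n]*nCk zero (suc k) = ℕₚ.*-zeroʳ (suc (suc k))
[1+k]*[1+n]C[1+k]≡[1+n]*nCk (suc n) (suc k) = begin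
  suc (suc k) ℕ.* (suc (suc n) C suc (suc k))
    ≡⟨ ≡.cong (suc (suc k) ℕ.*_) (pascal (suc n) (suc k)) ⟨
  suc (suc k) ℕ.* (suc n C suc k ℕ.+ suc n C suc (suc k))
    ≡⟨ ℕₚ.*-distribˡ-+ (suc (suc k)) (suc n C suc k) _ ⟩
  (suc n C suc k ℕ.+ suc k ℕ.* (suc n C suc k)) ℕ.+ suc (suc k) ℕ.* (suc n C suc (suc k))
    ≡⟨ ≡.cong₂ (λ a b → (suc n C suc k ℕ.+ a) ℕ.+ b)
         ([1+k]*[1+n]C[1+k]≡[1+n]*nCk n k) ([1+k]*[1+n]C[1+k]≡[1+n]*nCk n (suc k)) ⟩
  (suc n C suc k ℕ.+ suc n ℕ.* (n C k)) ℕ.+ suc n ℕ.* (n C suc k)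
    ≡⟨ ≡.cong (λ a → (a ℕ.+ suc n ℕ.* (n C k)) ℕ.+ suc n ℕ.* (n C suc k)) (pascal n k) ⟨
  ((n C k ℕ.+ n C suc k) ℕ.+ suc n ℕ.* (n C k)) ℕ.+ suc n ℕ.* (n C suc k)
    ≡⟨ solve 3 (λ n a b → ((a :+ b) :+ (con 1 :+ n) :* a) :+ (con 1 :+ n) :* b
                          := (con 2 :+ n) :* (a :+ b)) ≡.refl n (n C k) (n C suc k) ⟩
  suc (suc n) ℕ.* (n C k ℕ.+ n C suc k)
    ≡⟨ ≡.cong (suc (suc n) ℕ.*_) (pascal n k) ⟩
  suc (suc n) ℕ.* (suc n C suc k) ∎
  where
  open ≡.≡-Reasoning
  open +-*-Solver using (solve; _:=_; _:+_; _:*_; con)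
  pascal : ∀ n k → n C k ℕ.+ n C suc k ≡ suc n C suc k
  pascal = nCk+nC[k+1]≡[n+1]C[k+1]

module _ {a ℓ} (K : Field a ℓ) where
  open Field K
  open import Algebra.Properties.Ring ring
    using (-‿distribˡ-*; -‿distribʳ-*; -‿involutive; -0#≈0#; +-inverseʳ-unique; x+x≈x⇒x≈0)
  open import Algebra.Properties.Semiring.Mult semiring using (_×_; ×-homo-+; ×1-homo-*)
  open import Algebra.Properties.Semiring.Exp semiring using (_^_)
  open import Relation.Binary.Reasoning.Setoid setoid
  open import Algebra.Solver.Ring.NaturalCoefficients.Default commutativeSemiring
    using (solve; _:=_; _:+_; _:*_)

  x*y≈0⇒y≈0 : ∀ {x y} → ¬ x ≈ 0# → x * y ≈ 0# → y ≈ 0#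
  x*y≈0⇒y≈0 {x} {y} x≉0 xy≈0 = begin
    y                    ≈⟨ *-identityˡ y ⟨
    1# * y               ≈⟨ *-congʳ (trans (*-comm _ x) (inverse x x≉0)) ⟨
    (inv x x≉0 * x) * y  ≈⟨ *-assoc _ x y ⟩
    inv x x≉0 * (x * y)  ≈⟨ *-congˡ xy≈0 ⟩
    inv x x≉0 * 0#       ≈⟨ zeroʳ _ ⟩
    0#                   ∎

  *-≉0 : ∀ {x y} → ¬ x ≈ 0# → ¬ y ≈ 0# → ¬ x * y ≈ 0#
  *-≉0 x≉0 y≉0 = y≉0 ∘ x*y≈0⇒y≈0 x≉0

  -‿≉0 : ∀ {x} → ¬ x ≈ 0# → ¬ - x ≈ 0#
  -‿≉0 {x} x≉0 -x≈0 = x≉0 (trans (sym (-‿involutive x)) (trans (-‿cong -x≈0) -0#≈0#))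

  ^-≉0 : ∀ {x} → ¬ x ≈ 0# → ∀ n → ¬ x ^ n ≈ 0#
  ^-≉0 x≉0 zero    = 1≉0
  ^-≉0 x≉0 (suc n) = *-≉0 x≉0 (^-≉0 x≉0 n)

  inv-≉0 : ∀ {x} (x≉0 : ¬ x ≈ 0#) → ¬ inv x x≉0 ≈ 0#
  inv-≉0 {x} x≉0 x⁻¹≈0 = 1≉0 (trans (sym (inverse x x≉0)) (trans (*-congˡ x⁻¹≈0) (zeroʳ x)))

  ι≡×1 : ∀ n → ι K n ≡ n × 1#
  ι≡×1 zero    = ≡.refl
  ι≡×1 (suc n) = ≡.cong (1# +_) (ι≡×1 n)

  ι-homo-+ : ∀ m n → ι K (m ℕ.+ n) ≈ ι K m + ι K n
  ι-homo-+ m n = begin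
    ι K (m ℕ.+ n)         ≡⟨ ι≡×1 (m ℕ.+ n) ⟩
    (m ℕ.+ n) × 1#        ≈⟨ ×-homo-+ 1# m n ⟩
    m × 1# + n × 1#       ≡⟨ ≡.cong₂ _+_ (ι≡×1 m) (ι≡×1 n) ⟨
    ι K m + ι K n         ∎

  ι-homo-* : ∀ m n → ι K (m ℕ.* n) ≈ ι K m * ι K n
  ι-homo-* m n = begin
    ι K (m ℕ.* n)         ≡⟨ ι≡×1 (m ℕ.* n) ⟩
    (m ℕ.* n) × 1#        ≈⟨ ×1-homo-* m n ⟩
    m × 1# * n × 1#       ≡⟨ ≡.cong₂ _*_ (ι≡×1 m) (ι≡×1 n) ⟨
    ι K m * ι K n         ∎

  ι1≈1 : ι K 1 ≈ 1#
  ι1≈1 = +-identityʳ 1#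

  ι1*x≈x : ∀ x → ι K 1 * x ≈ x
  ι1*x≈x x = trans (*-congʳ ι1≈1) (*-identityˡ x)

  ι[pCi]≈0 : ∀ {p i} → HasCharacteristic K p → 0 < i → i < p → ι K (p C i) ≈ 0#
  ι[pCi]≈0 {suc p} {suc i} (_ , ι[p]≈0 , ι≉0) _ i<p = x*y≈0⇒y≈0 (ι≉0 (suc i) z<s i<p) (begin
    ι K (suc i) * ι K (suc p C suc i)      ≈⟨ ι-homo-* (suc i) (suc p C suc i) ⟨
    ι K (suc i ℕ.* (suc p C suc i))        ≡⟨ ≡.cong (ι K) ([1+k]*[1+n]C[1+k]≡[1+n]*nCk p i) ⟩
    ι K (suc p ℕ.* (p C i))                ≈⟨ ι-homo-* (suc p) (p C i) ⟩
    ι K (suc p) * ι K (p C i)              ≈⟨ *-congʳ ι[p]≈0 ⟩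
    0# * ι K (p C i)                       ≈⟨ zeroˡ _ ⟩
    0#                                     ∎)

  ι[m!]≉0 : ∀ {p m} → HasCharacteristic K p → m < p → ¬ ι K (m !) ≈ 0#
  ι[m!]≉0 {m = zero}  _                 _   = 1≉0 ∘ trans (sym ι1≈1)
  ι[m!]≉0 {m = suc m} char@(_ , _ , ι≉0) m<p ι[m!]≈0 =
    *-≉0 (ι≉0 (suc m) z<s m<p) (ι[m!]≉0 char (<-trans (n<1+n m) m<p))
      (trans (sym (ι-homo-* (suc m) (m !))) ι[m!]≈0)

  characteristic>1 : ∀ {p} → HasCharacteristic K p → 1 < p
  characteristic>1 {suc zero}    (_ , ι[1]≈0 , _) = contradiction (trans (sym ι1≈1) ι[1]≈0) 1≉0
  characteristic>1 {suc (suc p)} _                = s≤s z<s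

  iter-sucʳ : ∀ f n x → iter K f n (f x) ≡ iter K f (suc n) x
  iter-sucʳ f zero    x = ≡.refl
  iter-sucʳ f (suc n) x = ≡.cong f (iter-sucʳ f n x)

  iter-+ : ∀ f m n x → iter K f (m ℕ.+ n) x ≡ iter K f m (iter K f n x)
  iter-+ f zero    n x = ≡.refl
  iter-+ f (suc m) n x = ≡.cong f (iter-+ f m n x)

  iter-* : ∀ f m n x → iter K f (m ℕ.* n) x ≡ iter K (iter K f n) m x
  iter-* f zero    n x = ≡.refl
  iter-* f (suc m) n x = ≡.trans (iter-+ f n (m ℕ.* n) x) (≡.cong (iter K f n) (iter-* f m n x))

  iter-cong : ∀ {f} → (∀ {x y} → x ≈ y → f x ≈ f y) → ∀ n {x y} → x ≈ y → iter K f n x ≈ iter K f n y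
  iter-cong f-cong zero    x≈y = x≈y
  iter-cong f-cong (suc n) x≈y = f-cong (iter-cong f-cong n x≈y)

  ∑antidiagonal : ℕ → (ℕ → ℕ → Carrier) → Carrier
  ∑antidiagonal zero    F = F 0 0
  ∑antidiagonal (suc n) F = F 0 (suc n) + ∑antidiagonal n (λ i j → F (suc i) j)

  ∑antidiagonal-cong : ∀ n {F G} → (∀ i j → F i j ≈ G i j) → ∑antidiagonal n F ≈ ∑antidiagonal n G
  ∑antidiagonal-cong zero    F≈G = F≈G 0 0
  ∑antidiagonal-cong (suc n) F≈G = +-cong (F≈G 0 (suc n)) (∑antidiagonal-cong n (F≈G ∘ suc))

  ∑antidiagonal-+ : ∀ n F G → ∑antidiagonal n (λ i j → F i j + G i j) ≈ ∑antidiagonal n F + ∑antidiagonal n G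
  ∑antidiagonal-+ zero    F G = refl
  ∑antidiagonal-+ (suc n) F G = trans (+-congˡ (∑antidiagonal-+ n _ _)) (+-medial _ _ _ _)
    where
    +-medial : ∀ a b c d → (a + b) + (c + d) ≈ (a + c) + (b + d)
    +-medial = solve 4 (λ a b c d → (a :+ b) :+ (c :+ d) := (a :+ c) :+ (b :+ d)) refl

  ∑antidiagonal-sucʳ : ∀ n F → ∑antidiagonal (suc n) F ≈ ∑antidiagonal n (λ i j → F i (suc j)) + F (suc n) 0
  ∑antidiagonal-sucʳ zero    F = refl
  ∑antidiagonal-sucʳ (suc n) F = trans (+-congˡ (∑antidiagonal-sucʳ n (F ∘ suc))) (sym (+-assoc _ _ _))

  ∑antidiagonal-last : ∀ n F → (∀ i j → i < n → F i j ≈ 0#) → ∑antidiagonal n F ≈ F n 0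
  ∑antidiagonal-last zero    F _   = refl
  ∑antidiagonal-last (suc n) F F≈0 = begin
    F 0 (suc n) + ∑antidiagonal n (F ∘ suc)
      ≈⟨ +-cong (F≈0 0 (suc n) z<s) (∑antidiagonal-last n (F ∘ suc) (λ i j → F≈0 (suc i) j ∘ s≤s)) ⟩
    0# + F (suc n) 0
      ≈⟨ +-identityˡ _ ⟩
    F (suc n) 0 ∎

  binomialSum : ℕ → (ℕ → ℕ → Carrier) → Carrier
  binomialSum n F = ∑antidiagonal n (λ i j → ι K (n C i) * F i j)

  binomialSum-suc : ∀ n F → binomialSum (suc n) F ≈
                    binomialSum n (λ i j → F (suc i) j) + binomialSum n (λ i j → F i (suc j))
  binomialSum-suc n F = begin
    binomialSum (suc n) F
      ≡⟨⟩
    G 0 (suc n) + ∑antidiagonal n (λ i j → ι K (suc n C suc i) * F (suc i) j)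
      ≈⟨ +-congˡ (∑antidiagonal-cong n λ i j → pascal i (F (suc i) j)) ⟩
    G 0 (suc n) + ∑antidiagonal n (λ i j → ι K (n C i) * F (suc i) j + G (suc i) j)
      ≈⟨ +-congˡ (∑antidiagonal-+ n _ _) ⟩
    G 0 (suc n) + (X + Y)
      ≈⟨ solve 3 (λ g x y → g :+ (x :+ y) := x :+ (g :+ y)) refl (G 0 (suc n)) X Y ⟩
    X + ∑antidiagonal (suc n) G
      ≈⟨ +-congˡ (∑antidiagonal-sucʳ n G) ⟩
    X + (binomialSum n (λ i j → F i (suc j)) + G (suc n) 0)
      ≈⟨ +-congˡ (trans (+-congˡ G[1+n,0]≈0) (+-identityʳ _)) ⟩
    X + binomialSum n (λ i j → F i (suc j)) ∎
    where
    G : ℕ → ℕ → Carrier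
    G i j = ι K (n C i) * F i j
    X Y : Carrier
    X = binomialSum n (λ i j → F (suc i) j)
    Y = ∑antidiagonal n (λ i j → G (suc i) j)
    pascal : ∀ i x → ι K (suc n C suc i) * x ≈ ι K (n C i) * x + ι K (n C suc i) * x
    pascal i x = begin
      ι K (suc n C suc i) * x                  ≡⟨ ≡.cong (λ m → ι K m * x) (nCk+nC[k+1]≡[n+1]C[k+1] n i) ⟨
      ι K (n C i ℕ.+ n C suc i) * x            ≈⟨ *-congʳ (ι-homo-+ (n C i) (n C suc i)) ⟩
      (ι K (n C i) + ι K (n C suc i)) * x      ≈⟨ distribʳ x _ _ ⟩
      ι K (n C i) * x + ι K (n C suc i) * x    ∎
    G[1+n,0]≈0 : G (suc n) 0 ≈ 0#
    G[1+n,0]≈0 = trans (*-congʳ (reflexive (≡.cong (ι K) (k>n⇒nCk≡0 (n<1+n n))))) (zeroˡ _)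

  binomialSum-characteristic : ∀ {p} → HasCharacteristic K p → ∀ F → binomialSum p F ≈ F 0 p + F p 0
  binomialSum-characteristic {suc p} char F = +-cong (ι1*x≈x _) (begin
    ∑antidiagonal p (λ i j → ι K (suc p C suc i) * F (suc i) j)
      ≈⟨ ∑antidiagonal-last p _ (λ i j i<p → trans (*-congʳ (ι[pCi]≈0 char z<s (s≤s i<p))) (zeroˡ _)) ⟩
    ι K (suc p C suc p) * F (suc p) 0
      ≈⟨ trans (*-congʳ (reflexive (≡.cong (ι K) (nCn≡1 (suc p))))) (ι1*x≈x _) ⟩
    F (suc p) 0 ∎)

  isDerivation-resp-≗ : ∀ {f g} → f ≗ g → IsDerivation K f → IsDerivation K g
  isDerivation-resp-≗ {f} {g} f≗g f-isDerivation = record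
    { ∂-cong     = λ x≈y → trans (g≈f _) (trans (∂-cong x≈y) (reflexive (f≗g _)))
    ; ∂-additive = λ a b → trans (g≈f _) (trans (∂-additive a b) (+-cong (reflexive (f≗g a)) (reflexive (f≗g b))))
    ; ∂-leibniz  = λ a b → trans (g≈f _) (trans (∂-leibniz a b)
                             (+-cong (*-congʳ (reflexive (f≗g a))) (*-congˡ (reflexive (f≗g b)))))
    }
    where
    open IsDerivation f-isDerivation
    g≈f : ∀ x → g x ≈ f x
    g≈f x = reflexive (≡.sym (f≗g x))

  module DerivationProperties {∂ : Carrier → Carrier} (∂-isDerivation : IsDerivation K ∂) where
    open IsDerivation ∂-isDerivation public

    ∂0≈0 : ∂ 0# ≈ 0#
    ∂0≈0 = x+x≈x⇒x≈0 (∂ 0#) (trans (sym (∂-additive 0# 0#)) (∂-cong (+-identityʳ 0#)))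

    ∂1≈0 : ∂ 1# ≈ 0#
    ∂1≈0 = x+x≈x⇒x≈0 (∂ 1#) (begin
      ∂ 1# + ∂ 1#             ≈⟨ +-cong (*-identityʳ _) (*-identityˡ _) ⟨
      ∂ 1# * 1# + 1# * ∂ 1#   ≈⟨ ∂-leibniz 1# 1# ⟨
      ∂ (1# * 1#)             ≈⟨ ∂-cong (*-identityʳ 1#) ⟩
      ∂ 1#                    ∎)

    ∂ι≈0 : ∀ n → ∂ (ι K n) ≈ 0#
    ∂ι≈0 zero    = ∂0≈0
    ∂ι≈0 (suc n) = trans (∂-additive 1# (ι K n)) (trans (+-cong ∂1≈0 (∂ι≈0 n)) (+-identityʳ 0#))

    ∂[-x]≈-∂x : ∀ x → ∂ (- x) ≈ - ∂ x
    ∂[-x]≈-∂x x = +-inverseʳ-unique (∂ x) (∂ (- x))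
      (trans (sym (∂-additive x (- x))) (trans (∂-cong (-‿inverseʳ x)) ∂0≈0))

    ∂[a*x]≈a*∂x : ∀ {a} x → ∂ a ≈ 0# → ∂ (a * x) ≈ a * ∂ x
    ∂[a*x]≈a*∂x {a} x ∂a≈0 = begin
      ∂ (a * x)              ≈⟨ ∂-leibniz a x ⟩
      ∂ a * x + a * ∂ x      ≈⟨ +-congʳ (trans (*-congʳ ∂a≈0) (zeroˡ x)) ⟩
      0# + a * ∂ x           ≈⟨ +-identityˡ _ ⟩
      a * ∂ x                ∎

    ∂[x*y]≈0 : ∀ {x y} → ∂ x ≈ 0# → ∂ y ≈ 0# → ∂ (x * y) ≈ 0#
    ∂[x*y]≈0 {x} ∂x≈0 ∂y≈0 = trans (∂[a*x]≈a*∂x _ ∂x≈0) (trans (*-congˡ ∂y≈0) (zeroʳ x))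

    ∂[-x]≈0 : ∀ {x} → ∂ x ≈ 0# → ∂ (- x) ≈ 0#
    ∂[-x]≈0 {x} ∂x≈0 = trans (∂[-x]≈-∂x x) (trans (-‿cong ∂x≈0) -0#≈0#)

    ∂[x^n]≈0 : ∀ {x} → ∂ x ≈ 0# → ∀ n → ∂ (x ^ n) ≈ 0#
    ∂[x^n]≈0 ∂x≈0 zero    = ∂1≈0
    ∂[x^n]≈0 ∂x≈0 (suc n) = ∂[x*y]≈0 ∂x≈0 (∂[x^n]≈0 ∂x≈0 n)

    ∂[x^1+n]≈[1+n]x^n∂x : ∀ x n → ∂ (x ^ suc n) ≈ ι K (suc n) * (x ^ n * ∂ x)
    ∂[x^1+n]≈[1+n]x^n∂x x zero = begin
      ∂ (x * 1#)                  ≈⟨ ∂-cong (*-identityʳ x) ⟩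
      ∂ x                         ≈⟨ *-identityˡ (∂ x) ⟨
      1# * ∂ x                    ≈⟨ ι1*x≈x (1# * ∂ x) ⟨
      ι K 1 * (1# * ∂ x)          ∎
    ∂[x^1+n]≈[1+n]x^n∂x x (suc n) = begin
      ∂ (x * x ^ suc n)                                    ≈⟨ ∂-leibniz x (x ^ suc n) ⟩
      ∂ x * x ^ suc n + x * ∂ (x ^ suc n)                  ≈⟨ +-congˡ (*-congˡ (∂[x^1+n]≈[1+n]x^n∂x x n)) ⟩
      ∂ x * (x * x ^ n) + x * (ι K (suc n) * (x ^ n * ∂ x))
        ≈⟨ solve 4 (λ d x y i → d :* (x :* y) :+ x :* (i :* (y :* d)) := (x :* y :* d) :+ i :* (x :* y :* d))
                 refl (∂ x) x (x ^ n) (ι K (suc n)) ⟩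
      x ^ suc n * ∂ x + ι K (suc n) * (x ^ suc n * ∂ x)    ≈⟨ +-congʳ (ι1*x≈x _) ⟨
      ι K 1 * (x ^ suc n * ∂ x) + ι K (suc n) * (x ^ suc n * ∂ x)
                                                           ≈⟨ distribʳ _ (ι K 1) (ι K (suc n)) ⟨
      (ι K 1 + ι K (suc n)) * (x ^ suc n * ∂ x)            ≈⟨ *-congʳ (ι-homo-+ 1 (suc n)) ⟨
      ι K (suc (suc n)) * (x ^ suc n * ∂ x)                ∎

    ∂[x^p]≈0 : ∀ {p} → HasCharacteristic K p → ∀ x → ∂ (x ^ p) ≈ 0#
    ∂[x^p]≈0 {suc p} (_ , ι[p]≈0 , _) x =
      trans (∂[x^1+n]≈[1+n]x^n∂x x p) (trans (*-congʳ ι[p]≈0) (zeroˡ _))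

    ∂[x⁻¹]≈-∂x*x⁻¹*x⁻¹ : ∀ {x} (x≉0 : ¬ x ≈ 0#) → ∂ (inv x x≉0) ≈ - (∂ x * (inv x x≉0 * inv x x≉0))
    ∂[x⁻¹]≈-∂x*x⁻¹*x⁻¹ {x} x≉0 = begin
      ∂ x⁻¹                          ≈⟨ *-identityˡ _ ⟨
      1# * ∂ x⁻¹                     ≈⟨ *-congʳ (trans (*-comm x⁻¹ x) (inverse x x≉0)) ⟨
      (x⁻¹ * x) * ∂ x⁻¹              ≈⟨ *-assoc x⁻¹ x _ ⟩
      x⁻¹ * (x * ∂ x⁻¹)              ≈⟨ *-congˡ x∂x⁻¹≈-∂x*x⁻¹ ⟩
      x⁻¹ * - (∂ x * x⁻¹)            ≈⟨ -‿distribʳ-* x⁻¹ _ ⟨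
      - (x⁻¹ * (∂ x * x⁻¹))          ≈⟨ -‿cong (solve 2 (λ y d → y :* (d :* y) := d :* (y :* y)) refl x⁻¹ (∂ x)) ⟩
      - (∂ x * (x⁻¹ * x⁻¹))          ∎
      where
      x⁻¹ : Carrier
      x⁻¹ = inv x x≉0
      x∂x⁻¹≈-∂x*x⁻¹ : x * ∂ x⁻¹ ≈ - (∂ x * x⁻¹)
      x∂x⁻¹≈-∂x*x⁻¹ = +-inverseʳ-unique (∂ x * x⁻¹) (x * ∂ x⁻¹)
        (trans (sym (∂-leibniz x x⁻¹)) (trans (∂-cong (inverse x x≉0)) ∂1≈0))

    iter-additive : ∀ n a b → iter K ∂ n (a + b) ≈ iter K ∂ n a + iter K ∂ n b
    iter-additive zero    a b = refl
    iter-additive (suc n) a b = trans (∂-cong (iter-additive n a b)) (∂-additive _ _)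

    iter∂0≈0 : ∀ n → iter K ∂ n 0# ≈ 0#
    iter∂0≈0 zero    = refl
    iter∂0≈0 (suc n) = trans (∂-cong (iter∂0≈0 n)) ∂0≈0

    ∂x≈0⇒iter∂x≈0 : ∀ {x} → ∂ x ≈ 0# → ∀ n → iter K ∂ (suc n) x ≈ 0#
    ∂x≈0⇒iter∂x≈0 {x} ∂x≈0 n = begin
      iter K ∂ (suc n) x    ≡⟨ iter-sucʳ ∂ n x ⟨
      iter K ∂ n (∂ x)      ≈⟨ iter-cong ∂-cong n ∂x≈0 ⟩
      iter K ∂ n 0#         ≈⟨ iter∂0≈0 n ⟩
      0#                    ∎

    iter∂[a*x]≈a*iter∂x : ∀ {a} x → ∂ a ≈ 0# → ∀ n → iter K ∂ n (a * x) ≈ a * iter K ∂ n x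
    iter∂[a*x]≈a*iter∂x x ∂a≈0 zero    = refl
    iter∂[a*x]≈a*iter∂x x ∂a≈0 (suc n) = trans (∂-cong (iter∂[a*x]≈a*iter∂x x ∂a≈0 n)) (∂[a*x]≈a*∂x _ ∂a≈0)

    iter-riccati : ∀ {b v} → ∂ b ≈ 0# → ∂ v ≈ b * (v * v) →
                   ∀ m → iter K ∂ m v ≈ ι K (m !) * (b ^ m * v ^ suc m)
    iter-riccati {b} {v} ∂b≈0 ∂v≈bv² zero = begin
      v                        ≈⟨ *-identityʳ v ⟨
      v * 1#                   ≈⟨ *-identityˡ _ ⟨
      1# * (v * 1#)            ≈⟨ ι1*x≈x _ ⟨
      ι K 1 * (1# * (v * 1#))  ∎
    iter-riccati {b} {v} ∂b≈0 ∂v≈bv² (suc m) = begin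
      ∂ (iter K ∂ m v)                                        ≈⟨ ∂-cong (iter-riccati ∂b≈0 ∂v≈bv² m) ⟩
      ∂ (ι K (m !) * (b ^ m * v ^ suc m))                     ≈⟨ ∂[a*x]≈a*∂x _ (∂ι≈0 (m !)) ⟩
      ι K (m !) * ∂ (b ^ m * v ^ suc m)                       ≈⟨ *-congˡ (∂[a*x]≈a*∂x _ (∂[x^n]≈0 ∂b≈0 m)) ⟩
      ι K (m !) * (b ^ m * ∂ (v ^ suc m))                     ≈⟨ *-congˡ (*-congˡ (∂[x^1+n]≈[1+n]x^n∂x v m)) ⟩
      ι K (m !) * (b ^ m * (ι K (suc m) * (v ^ m * ∂ v)))     ≈⟨ *-congˡ (*-congˡ (*-congˡ (*-congˡ ∂v≈bv²))) ⟩
      ι K (m !) * (b ^ m * (ι K (suc m) * (v ^ m * (b * (v * v)))))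
        ≈⟨ solve 6 (λ f bm i vm b v → f :* (bm :* (i :* (vm :* (b :* (v :* v)))))
                                      := (i :* f) :* ((b :* bm) :* (v :* (v :* vm))))
                 refl (ι K (m !)) (b ^ m) (ι K (suc m)) (v ^ m) b v ⟩
      (ι K (suc m) * ι K (m !)) * (b ^ suc m * v ^ suc (suc m)) ≈⟨ *-congʳ (ι-homo-* (suc m) (m !)) ⟨
      ι K (suc m !) * (b ^ suc m * v ^ suc (suc m))          ∎

    ∂-∑antidiagonal : ∀ n F → ∂ (∑antidiagonal n F) ≈ ∑antidiagonal n (λ i j → ∂ (F i j))
    ∂-∑antidiagonal zero    F = refl
    ∂-∑antidiagonal (suc n) F = trans (∂-additive _ _) (+-congˡ (∂-∑antidiagonal n (F ∘ suc)))

    ∂-binomialSum : ∀ n F → ∂ (binomialSum n F) ≈ binomialSum n (λ i j → ∂ (F i j))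
    ∂-binomialSum n F =
      trans (∂-∑antidiagonal n _) (∑antidiagonal-cong n (λ i j → ∂[a*x]≈a*∂x _ (∂ι≈0 (n C i))))

    leibniz : ∀ n f g → iter K ∂ n (f * g) ≈ binomialSum n (λ i j → iter K ∂ i f * iter K ∂ j g)
    leibniz zero    f g = sym (ι1*x≈x (f * g))
    leibniz (suc n) f g = begin
      ∂ (iter K ∂ n (f * g))                                    ≈⟨ ∂-cong (leibniz n f g) ⟩
      ∂ (binomialSum n F)                                       ≈⟨ ∂-binomialSum n F ⟩
      binomialSum n (λ i j → ∂ (F i j))                         ≈⟨ ∑antidiagonal-cong n (λ i j → *-congˡ (∂-leibniz _ _)) ⟩
      binomialSum n (λ i j → F (suc i) j + F i (suc j))         ≈⟨ ∑antidiagonal-cong n (λ i j → distribˡ _ _ _) ⟩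
      ∑antidiagonal n (λ i j → ι K (n C i) * F (suc i) j + ι K (n C i) * F i (suc j))
                                                                ≈⟨ ∑antidiagonal-+ n _ _ ⟩
      binomialSum n (λ i j → F (suc i) j) + binomialSum n (λ i j → F i (suc j))
                                                                ≈⟨ binomialSum-suc n F ⟨
      binomialSum (suc n) F                                     ∎
      where
      F : ℕ → ℕ → Carrier
      F i j = iter K ∂ i f * iter K ∂ j g

  iter-characteristic-isDerivation : ∀ {p ∂} → HasCharacteristic K p → IsDerivation K ∂ → IsDerivation K (iter K ∂ p)
  iter-characteristic-isDerivation {p} {∂} char ∂-isDerivation = record
    { ∂-cong     = iter-cong ∂-cong p
    ; ∂-additive = iter-additive p
    ; ∂-leibniz  = λ f g → trans (leibniz p f g) (trans (binomialSum-characteristic char _) (+-comm _ _))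
    }
    where open DerivationProperties ∂-isDerivation

  iter-^-isDerivation : ∀ {p ∂} → HasCharacteristic K p → IsDerivation K ∂ → ∀ k → IsDerivation K (iter K ∂ (p ℕ.^ k))
  iter-^-isDerivation char ∂-isDerivation zero = ∂-isDerivation
  iter-^-isDerivation {p} {∂} char ∂-isDerivation (suc k) =
    isDerivation-resp-≗ (≡.sym ∘ iter-* ∂ p (p ℕ.^ k))
      (iter-characteristic-isDerivation char (iter-^-isDerivation char ∂-isDerivation k))

  InConstantsˣ-resp-≈ : ∀ {∂} → IsDerivation K ∂ → ∀ {x y} → x ≈ y → InConstantsˣ K ∂ y → InConstantsˣ K ∂ x
  InConstantsˣ-resp-≈ ∂-isDerivation x≈y (∂y≈0 , y≉0) = trans (∂-cong x≈y) ∂y≈0 , y≉0 ∘ trans (sym x≈y)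
    where open IsDerivation ∂-isDerivation

  private
    module Logarithm
      {∂ : Carrier → Carrier} (∂-isDerivation : IsDerivation K ∂)
      {M : ℕ} (D-isDerivation : IsDerivation K (iter K ∂ (suc M)))
      {u y : Carrier} (∂Du≈0 : ∂ (iter K ∂ (suc M) u) ≈ 0#)
      (u≉0 : ¬ u ≈ 0#) (∂y≈∂u/u : ∂ y ≈ ∂ u * inv u u≉0)
      where

      open DerivationProperties ∂-isDerivation
      module D = DerivationProperties D-isDerivation

      D : Carrier → Carrier
      D = iter K ∂ (suc M)

      c v : Carrier
      c = D u
      v = inv u u≉0

      D≈D : ∀ {x x′} → ∂ x ≈ ∂ x′ → D x ≈ D x′
      D≈D {x} {x′} ∂x≈∂x′ = begin
        D x                 ≡⟨ iter-sucʳ ∂ M x ⟨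
        iter K ∂ M (∂ x)    ≈⟨ iter-cong ∂-cong M ∂x≈∂x′ ⟩
        iter K ∂ M (∂ x′)   ≡⟨ iter-sucʳ ∂ M x′ ⟩
        D x′                ∎

      Dc≈0 : D c ≈ 0#
      Dc≈0 = ∂x≈0⇒iter∂x≈0 ∂Du≈0 M

      ∂[Dy]≈∂[cv] : ∂ (D y) ≈ ∂ (c * v)
      ∂[Dy]≈∂[cv] = begin
        ∂ (D y)                   ≡⟨ iter-sucʳ ∂ (suc M) y ⟨
        D (∂ y)                   ≈⟨ D.∂-cong ∂y≈∂u/u ⟩
        D (∂ u * v)               ≈⟨ D.∂-leibniz (∂ u) v ⟩
        D (∂ u) * v + ∂ u * D v   ≡⟨ ≡.cong (λ a → a * v + ∂ u * D v) (iter-sucʳ ∂ (suc M) u) ⟩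
        ∂ c * v + ∂ u * D v       ≈⟨ +-congˡ ∂u*Dv≈c*∂v ⟩
        ∂ c * v + c * ∂ v         ≈⟨ ∂-leibniz c v ⟨
        ∂ (c * v)                 ∎
        where
        ∂u*Dv≈c*∂v : ∂ u * D v ≈ c * ∂ v
        ∂u*Dv≈c*∂v = begin
          ∂ u * D v                    ≈⟨ *-congˡ (D.∂[x⁻¹]≈-∂x*x⁻¹*x⁻¹ u≉0) ⟩
          ∂ u * - (c * (v * v))        ≈⟨ -‿distribʳ-* (∂ u) _ ⟨
          - (∂ u * (c * (v * v)))      ≈⟨ -‿cong (solve 3 (λ a c w → a :* (c :* w) := c :* (a :* w)) refl (∂ u) c (v * v)) ⟩
          - (c * (∂ u * (v * v)))      ≈⟨ -‿distribʳ-* c _ ⟩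
          c * - (∂ u * (v * v))        ≈⟨ *-congˡ (∂[x⁻¹]≈-∂x*x⁻¹*x⁻¹ u≉0) ⟨
          c * ∂ v                      ∎

      iterD[Dy]≈c*iterDv : ∀ m → iter K D (suc m) (D y) ≈ c * iter K D (suc m) v
      iterD[Dy]≈c*iterDv m = begin
        iter K D (suc m) (D y)      ≡⟨ iter-sucʳ D m (D y) ⟨
        iter K D m (D (D y))        ≈⟨ iter-cong D.∂-cong m (D≈D ∂[Dy]≈∂[cv]) ⟩
        iter K D m (D (c * v))      ≡⟨ iter-sucʳ D m (c * v) ⟩
        iter K D (suc m) (c * v)    ≈⟨ D.iter∂[a*x]≈a*iter∂x v Dc≈0 (suc m) ⟩
        c * iter K D (suc m) v      ∎

      iterDv : ∀ m → iter K D m v ≈ ι K (m !) * ((- c) ^ m * v ^ suc m)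
      iterDv = D.iter-riccati (D.∂[-x]≈0 Dc≈0)
        (trans (D.∂[x⁻¹]≈-∂x*x⁻¹*x⁻¹ u≉0) (-‿distribˡ-* c (v * v)))

  iter-logarithm-InConstantsˣ :
    ∀ {p ∂} → HasCharacteristic K p → IsDerivation K ∂ →
    ∀ {N} → 0 < N → IsDerivation K (iter K ∂ N) →
    ∀ {u y} → InConstantsˣ K ∂ (iter K ∂ N u) → (u≉0 : ¬ u ≈ 0#) → ∂ y ≈ ∂ u * inv u u≉0 →
    InConstantsˣ K ∂ (iter K ∂ (p ℕ.* N) y)
  iter-logarithm-InConstantsˣ {p} {∂} char ∂-isDerivation {N = suc M} _ D-isDerivation {u} {y} (∂c≈0 , c≉0) u≉0 ∂y≈∂u/u
    with s≤s (s≤s {n = q} _) ← characteristic>1 char =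
    InConstantsˣ-resp-≈ ∂-isDerivation ∂ᵖᴺy≈closedForm
      ( ∂[x*y]≈0 ∂c≈0 (∂[x*y]≈0 (∂ι≈0 (suc q !)) (∂[x*y]≈0 (∂[x^n]≈0 (∂[-x]≈0 ∂c≈0) (suc q)) (∂[x^p]≈0 char v)))
      , *-≉0 c≉0 (*-≉0 (ι[m!]≉0 char (n<1+n (suc q))) (*-≉0 (^-≉0 (-‿≉0 c≉0) (suc q)) (^-≉0 (inv-≉0 u≉0) p)))
      )
    where
    open DerivationProperties ∂-isDerivation
    open Logarithm ∂-isDerivation {M} D-isDerivation ∂c≈0 u≉0 ∂y≈∂u/u
    ∂ᵖᴺy≈closedForm : iter K ∂ (p ℕ.* suc M) y ≈ c * (ι K (suc q !) * ((- c) ^ suc q * v ^ p))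
    ∂ᵖᴺy≈closedForm = begin
      iter K ∂ (p ℕ.* suc M) y         ≡⟨ iter-* ∂ p (suc M) y ⟩
      iter K D p y                     ≡⟨ iter-sucʳ D (suc q) y ⟨
      iter K D (suc q) (D y)           ≈⟨ iterD[Dy]≈c*iterDv q ⟩
      c * iter K D (suc q) v           ≈⟨ *-congˡ (iterDv (suc q)) ⟩
      c * (ι K (suc q !) * ((- c) ^ suc q * v ^ p)) ∎

open import Data.Nat using (_^_)

mainTheorem18 :
    ∀ {c ℓ} (K : Field c ℓ) (p : ℕ) → Prime p →
    HasCharacteristic K p →
    (∂ : Field.Carrier K → Field.Carrier K) → IsDerivation K ∂ →
    (k : ℕ) (u y : Field.Carrier K) →
    InConstantsˣ K ∂ (iter K ∂ (p ^ k) u) →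
    (u≉0 : ¬ (Field._≈_ K u (Field.0# K))) →
    Field._≈_ K (∂ y) (Field._*_ K (∂ u) (Field.inv K u u≉0)) →
    InConstantsˣ K ∂ (iter K ∂ (p ^ suc k) y)
mainTheorem18 K p _ char ∂ ∂-isDerivation k u y ∂ᵖᵏu∈Cˣ u≉0 ∂y≈∂u/u =
  iter-logarithm-InConstantsˣ K char ∂-isDerivation p^k>0 (iter-^-isDerivation K char ∂-isDerivation k)
    ∂ᵖᵏu∈Cˣ u≉0 ∂y≈∂u/u
  where
  p^k>0 : 0 < p ^ k
  p^k>0 = ℕₚ.m^n>0 p {{ℕ.>-nonZero (proj₁ char)}} k
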